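{- Let $n\ge 2$ and let $\tilde\rho_n$ be the partition $(n,n,n-2,n-2,\ldots,2,2)$ if $n$ is even and $(n,n,n-2,n-2,\ldots,3,3,2)$ if $n$ is odd. Let $G$ be the weighted directed graph whose vertices are the boxes $(i,j)$ of the Young diagram of $\tilde\rho_n$ (row $i$ counted from top, column $j$ from left), with a directed edge from each box to the box immediately above it and to the box immediately to its right (when these exist); every vertical edge has weight $1$ and every horizontal edge in row $i$ has weight $(-1)^{i-1}$. For vertices $x,y$ let $\mathrm{wt}(x,y)$ be the sum over all directed paths from $x$ to $y$ of the product of the edge weights. Let $S_1=(n,1)$, $S_2=(n,2)$, $T_1=(1,n)$, $T_2=(2,n)$. Then \[\begin{pmatrix}\mathrm{wt}(S_1,T_1)&\mathrm{wt}(S_1,T_2)\\ \mathrm{wt}(S_2,T_1)&\mathrm{wt}(S_2,T_2)\end{pmatrix}=\begin{cases}\begin{pmatrix}0&-C_{k-1}\\ C_{k-1}&C_{k-1}\end{pmatrix} & \text{if } n=2k,\\[2mm] \begin{pmatrix}C_k&*\\ 0&-C_{k-1}\end{pmatrix} & \text{if } n=2k+1,\end{cases}\] where $*$ denotes an entry that is not specified, and $C_k=\frac{(2k)!}{k!(k+1)!}$ is the $k$-th Catalan number.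
   Context: The trivial path from a vertex to itself has weight $1$. -}

module Defs where

open import Data.Nat using (ℕ; zero; suc; _+_; _*_; _∸_; _⊔_; _/_; _%_; _!; _≟_; _≤?_)
open import Data.Nat.Properties using (_!*_!≢0)

open import Data.Integer using (ℤ; +_; -_) renaming (_+_ to _+ℤ_; _*_ to _*ℤ_)
open import Data.Bool using (Bool; true; false; if_then_else_; _∧_)
open import Data.Product using (_×_; _,_)
open import Relation.Nullary.Decidable using (⌊_⌋)

catalan : ℕ → ℕ
catalan k = _/_ ((2 * k) !) (k ! * (suc k) !) {{k !* suc k !≢0}}

-- Length of row i (1-indexed, 1 ≤ i ≤ n) of the partition ρ̃_n:
-- rows come in pairs n,n,n-2,n-2,...; for n odd the last row (i = n) has length 2.
rowLen : ℕ → ℕ → ℕ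
rowLen n i = 2 ⊔ (n ∸ 2 * ((i ∸ 1) / 2))

-- A box (i , j): row i from the top, column j from the left (both 1-indexed).
Box : Set
Box = ℕ × ℕ

inDiagram : ℕ → Box → Bool
inDiagram n (i , j) = ⌊ 1 ≤? i ⌋ ∧ ⌊ i ≤? n ⌋ ∧ ⌊ 1 ≤? j ⌋ ∧ ⌊ j ≤? rowLen n i ⌋

boxEq : Box → Box → Bool
boxEq (i , j) (i' , j') = ⌊ i ≟ i' ⌋ ∧ ⌊ j ≟ j' ⌋

rowSign : ℕ → ℤ
rowSign i = if ⌊ ((i ∸ 1) % 2) ≟ 0 ⌋ then + 1 else - (+ 1)

-- walkWt n k x y : sum over all directed paths with exactly k edges from x to y
-- in the graph G on the diagram of ρ̃_n, of the product of edge weights.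
walkWt : ℕ → ℕ → Box → Box → ℤ
walkWt n zero x y = if boxEq x y then + 1 else + 0
walkWt n (suc k) (i , j) y = upPart +ℤ rightPart
  where
  upPart : ℤ
  upPart = if inDiagram n (i ∸ 1 , j) ∧ ⌊ 2 ≤? i ⌋ then walkWt n k (i ∸ 1 , j) y else + 0
  rightPart : ℤ
  rightPart = if inDiagram n (i , suc j) then rowSign i *ℤ walkWt n k (i , suc j) y else + 0

sumBelow : ℕ → (ℕ → ℤ) → ℤ
sumBelow zero f = + 0
sumBelow (suc m) f = sumBelow m f +ℤ f m

-- Every path visits distinct boxes (the graph is acyclic) so has fewer than n*n edges;
-- we sum over all path lengths k < n*n (the length-0 path x→x has weight 1).
wt : ℕ → Box → Box → ℤ
wt n x y = sumBelow (n * n) (λ k → walkWt n k x y)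

module Submission where

-- Every edge goes one row up or one column to the right, so all paths from (i , j) to (a , n) have
-- the same length n + i − a − j, and wt is a single walkWt.  Seen as a function of the start box,
-- the weight of the paths to a fixed target is determined by its values on the antidiagonal of the
-- target (1 there, 0 elsewhere) and the one-step recurrence "weight of the upper neighbour plus
-- (−1)^(i−1) times the weight of the right neighbour".  For the targets (1 , n) and (2 , n) we
-- write this function down in closed form: grouping the rows in pairs 2p+1, 2p+2 and counting the
-- boxes s to the right of a box, it is, up to sign and parity of s, an entry ballot x p of Catalan's
-- triangle, whose first column is the Catalan numbers.  The recurrence then becomes the recurrence
-- of Catalan's triangle, and reading the closed form at (n , 1) and (n , 2) gives the matrix.

open import Data.Nat
open import Data.Parity.Base using (Parity; 0ℙ; 1ℙ)
open import Data.Nat.Properties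
open import Data.Nat.DivMod using (_/_; _%_; m*n/n≡m; +-distrib-/-∣ʳ; m*n%n≡0; [m+kn]%n≡m%n)
open import Data.Nat.Divisibility using (divides-refl)
open import Data.Nat.Tactic.RingSolver using (solve-∀)
open import Data.Maybe using (Maybe; just; nothing; maybe′)
open import Data.Bool using (true; false; if_then_else_; _∧_)
open import Data.Product using (_×_; _,_; proj₁; ∃)
open import Data.Empty using (⊥-elim)
open import Data.Integer using (ℤ; +_; -_; _-_) renaming (_+_ to _+ℤ_; _*_ to _*ℤ_)
import Data.Integer.Properties as ℤ
open import Relation.Nullary using (Dec; yes; no)
open import Relation.Nullary.Decidable using (⌊_⌋; isYes≗does; dec-true)
open import Relation.Binary.PropositionalEquality
open import Function using (_∘_)
open import Defs

witness : ∀ {A : Set} (a? : Dec A) → ⌊ a? ⌋ ≡ true → A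
witness (yes a) _ = a

∧-true : ∀ {a b} → a ∧ b ≡ true → a ≡ true × b ≡ true
∧-true {true} b≡true = refl , b≡true

≤?-true : ∀ {m n} → m ≤ n → ⌊ m ≤? n ⌋ ≡ true
≤?-true {m} {n} m≤n = trans (isYes≗does (m ≤? n)) (dec-true (m ≤? n) m≤n)

if-true : ∀ {A : Set} {b} {x y : A} → b ≡ true → (if b then x else y) ≡ x
if-true refl = refl

if-false : ∀ {A : Set} {b} {x y : A} → b ≡ false → (if b then x else y) ≡ y
if-false refl = refl

if-collapse : ∀ {A : Set} b {x y : A} → (b ≡ true → x ≡ y) → (if b then x else y) ≡ y
if-collapse true x≡y = x≡y refl
if-collapse false _ = refl

if-cong : ∀ {A : Set} b {x x′ y : A} → (b ≡ true → x ≡ x′) → (if b then x else y) ≡ (if b then x′ else y)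
if-cong true x≡x′ = x≡x′ refl
if-cong false _ = refl

boxEq-refl : ∀ i {j j′} → j ≡ j′ → boxEq (i , j) (i , j′) ≡ true
boxEq-refl i {j} refl = cong₂ _∧_ (≟-true i) (≟-true j)
  where
  ≟-true : ∀ m → ⌊ m ≟ m ⌋ ≡ true
  ≟-true m = trans (isYes≗does (m ≟ m)) (dec-true (m ≟ m) refl)

-- Ballot numbers

ballot : ℕ → ℕ → ℕ
ballot x zero = 1
ballot zero (suc b) = ballot 1 b
ballot (suc x) (suc b) = ballot x (suc b) + ballot (suc (suc x)) b

-- Written with x + b and b * 2 so that every factorial unfolds by computation in the recursive cases.
ballot-closedForm : ∀ x b → ballot x b * (b ! * suc (x + b) !) ≡ suc x * (x + b * 2) !
ballot-closedForm x zero rewrite +-identityʳ x = trans (*-identityˡ _) (*-identityˡ _)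
ballot-closedForm zero (suc b) = begin
  ballot 1 b * ((suc b * b !) * suc (suc b) !)  ≡⟨ regroup b (ballot 1 b) (b !) (suc (suc b) !) ⟩
  suc b * (ballot 1 b * (b ! * suc (suc b) !))  ≡⟨ cong (suc b *_) (ballot-closedForm 1 b) ⟩
  suc b * (2 * suc (b * 2) !)                   ≡⟨ double b (suc (b * 2) !) ⟩
  1 * suc (suc (b * 2)) !                       ∎
  where
  open ≡-Reasoning
  regroup : ∀ b B f g → B * ((suc b * f) * g) ≡ suc b * (B * (f * g))
  regroup = solve-∀
  double : ∀ b h → suc b * (2 * h) ≡ 1 * (suc (suc (b * 2)) * h)
  double = solve-∀
ballot-closedForm (suc x) (suc b) = begin
  (B₁ + B₂) * ((suc b * b !) * (c * A))
    ≡⟨ split b c B₁ B₂ (b !) A ⟩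
  c * (B₁ * ((suc b * b !) * A)) + suc b * (B₂ * (b ! * (c * A)))
    ≡⟨ cong₂ (λ u v → c * u + suc b * v) (ballot-closedForm x (suc b)) shifted ⟩
  c * (suc x * K) + suc b * (suc (suc (suc x)) * K)
    ≡⟨ combine x b K ⟩
  suc (suc x) * (suc (x + suc (suc (b * 2))) * K)
    ∎
  where
  open ≡-Reasoning
  B₁ = ballot x (suc b)
  B₂ = ballot (suc (suc x)) b
  c = suc (suc (x + suc b))
  A = suc (x + suc b) !
  K = (x + suc (suc (b * 2))) !
  shifted : B₂ * (b ! * (c * A)) ≡ suc (suc (suc x)) * K
  shifted = begin
    B₂ * (b ! * (c * A))                               ≡⟨ cong (λ m → B₂ * (b ! * suc (suc m) !)) (+-suc x b) ⟩
    B₂ * (b ! * suc (suc (suc (x + b))) !)             ≡⟨ ballot-closedForm (suc (suc x)) b ⟩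
    suc (suc (suc x)) * (suc (suc (x + b * 2))) !
      ≡⟨ cong (λ m → suc (suc (suc x)) * m !) (trans (+-suc x (suc (b * 2))) (cong suc (+-suc x (b * 2)))) ⟨
    suc (suc (suc x)) * K  ∎
  split : ∀ b c B₁ B₂ f A → (B₁ + B₂) * ((suc b * f) * (c * A))
                            ≡ c * (B₁ * ((suc b * f) * A)) + suc b * (B₂ * (f * (c * A)))
  split = solve-∀
  combine : ∀ x b K → suc (suc (x + suc b)) * (suc x * K) + suc b * (suc (suc (suc x)) * K)
                      ≡ suc (suc x) * (suc (x + suc (suc (b * 2))) * K)
  combine = solve-∀

catalan≡ballot : ∀ k → catalan k ≡ ballot 0 k
catalan≡ballot k = begin
  (2 * k) ! / (k ! * suc k !)                      ≡⟨ cong (_/ (k ! * suc k !)) factorial ⟩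
  ballot 0 k * (k ! * suc k !) / (k ! * suc k !)   ≡⟨ m*n/n≡m (ballot 0 k) (k ! * suc k !) ⟩
  ballot 0 k                                       ∎
  where
  open ≡-Reasoning
  instance _ = k !* suc k !≢0
  factorial : (2 * k) ! ≡ ballot 0 k * (k ! * suc k !)
  factorial = trans (cong _! (*-comm 2 k)) (sym (trans (ballot-closedForm 0 k) (*-identityˡ _)))

-- Paths of a fixed length

sumBelow-vanishes : ∀ m f → (∀ k → k < m → f k ≡ + 0) → sumBelow m f ≡ + 0
sumBelow-vanishes zero f _ = refl
sumBelow-vanishes (suc m) f f≡0
  rewrite sumBelow-vanishes m f (λ k k<m → f≡0 k (m<n⇒m<1+n k<m)) | f≡0 m ≤-refl = refl

sumBelow-single : ∀ m f d → d < m → (∀ k → k ≢ d → f k ≡ + 0) → sumBelow m f ≡ f d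
sumBelow-single (suc m) f d d<1+m f≡0 with d ≟ m
... | yes refl = begin
  sumBelow d f +ℤ f d  ≡⟨ cong (_+ℤ f d) (sumBelow-vanishes d f (λ k k<d → f≡0 k (<⇒≢ k<d))) ⟩
  + 0 +ℤ f d           ≡⟨ ℤ.+-identityˡ (f d) ⟩
  f d                  ∎
  where open ≡-Reasoning
... | no d≢m = begin
  sumBelow m f +ℤ f m  ≡⟨ cong₂ _+ℤ_ (sumBelow-single m f d (≤∧≢⇒< (≤-pred d<1+m) d≢m) f≡0) (f≡0 m (d≢m ∘ sym)) ⟩
  f d +ℤ + 0           ≡⟨ ℤ.+-identityʳ (f d) ⟩
  f d                  ∎
  where open ≡-Reasoning

upStep : ℕ → (ℕ → ℕ → ℤ) → ℕ → ℕ → ℤ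
upStep n F i j = if inDiagram n (i ∸ 1 , j) ∧ ⌊ 2 ≤? i ⌋ then F (i ∸ 1) j else + 0

rightStep : ℕ → (ℕ → ℕ → ℤ) → ℕ → ℕ → ℤ
rightStep n F i j = if inDiagram n (i , suc j) then rowSign i *ℤ F i (suc j) else + 0

PathRecurrence : ℕ → (ℕ → ℕ → ℤ) → ℕ → ℕ → Set
PathRecurrence n F i j = F i j ≡ upStep n F i j +ℤ rightStep n F i j

walkWt-vanishes : ∀ n k i j a b → k + a + j ≢ b + i → walkWt n k (i , j) (a , b) ≡ + 0
walkWt-vanishes n zero i j a b wrongLength with boxEq (i , j) (a , b) in eq
... | false = refl
... | true with ∧-true eq
...   | i≟a , j≟b with refl ← witness (i ≟ a) i≟a | refl ← witness (j ≟ b) j≟b = ⊥-elim (wrongLength (+-comm a j))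
walkWt-vanishes n (suc k) i j a b wrongLength = cong₂ _+ℤ_ (up i wrongLength) right
  where
  W : ℕ → ℕ → ℤ
  W i′ j′ = walkWt n k (i′ , j′) (a , b)
  up : ∀ i → suc k + a + j ≢ b + i → upStep n W i j ≡ + 0
  up zero _ = refl
  up (suc i) wrongLength = if-collapse _ (λ _ →
    walkWt-vanishes n k i j a b (wrongLength ∘ λ e → trans (cong suc e) (sym (+-suc b i))))
  right : rightStep n W i j ≡ + 0
  right = if-collapse _ (λ _ → trans
    (cong (rowSign i *ℤ_) (walkWt-vanishes n k i (suc j) a b (wrongLength ∘ trans (sym (+-suc (k + a) j)))))
    (ℤ.*-zeroʳ (rowSign i)))

walkWt-unique : ∀ n a b (F : ℕ → ℕ → ℤ) →
  (∀ i j → inDiagram n (i , j) ≡ true → a + j ≡ b + i → F i j ≡ (if boxEq (i , j) (a , b) then + 1 else + 0)) →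
  (∀ d i j → inDiagram n (i , j) ≡ true → suc d + a + j ≡ b + i → PathRecurrence n F i j) →
  ∀ d i j → inDiagram n (i , j) ≡ true → d + a + j ≡ b + i → walkWt n d (i , j) (a , b) ≡ F i j
walkWt-unique n a b F base step zero i j inD dist = sym (base i j inD dist)
walkWt-unique n a b F base step (suc d) (suc i) j inD dist = begin
  upStep n W (suc i) j +ℤ rightStep n W (suc i) j  ≡⟨ cong₂ _+ℤ_ up right ⟩
  upStep n F (suc i) j +ℤ rightStep n F (suc i) j  ≡⟨ step d (suc i) j inD dist ⟨
  F (suc i) j                                      ∎
  where
  open ≡-Reasoning
  W : ℕ → ℕ → ℤ
  W i′ j′ = walkWt n d (i′ , j′) (a , b)
  up : upStep n W (suc i) j ≡ upStep n F (suc i) j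
  up = if-cong _ (λ e → walkWt-unique n a b F base step d i j (proj₁ (∧-true e)) (suc-injective (trans dist (+-suc b i))))
  right : rightStep n W (suc i) j ≡ rightStep n F (suc i) j
  right = if-cong _ (λ e → cong (rowSign (suc i) *ℤ_)
    (walkWt-unique n a b F base step d (suc i) (suc j) e (trans (+-suc (d + a) j) dist)))

wt≡walkWt : ∀ n i j a b d → d < n * n → d + a + j ≡ b + i → wt n (i , j) (a , b) ≡ walkWt n d (i , j) (a , b)
wt≡walkWt n i j a b d d<n² dist = sumBelow-single (n * n) (λ k → walkWt n k (i , j) (a , b)) d d<n² λ k k≢d →
  walkWt-vanishes n k i j a b λ dist′ → k≢d (+-cancelʳ-≡ a k d (+-cancelʳ-≡ j (k + a) (d + a) (trans dist′ (sym dist))))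

-- Coordinates on the diagram

record InDiagram (n i j : ℕ) : Set where
  constructor mkInDiagram
  field
    row≥1 : 1 ≤ i
    row≤n : i ≤ n
    col≥1 : 1 ≤ j
    col≤rowLen : j ≤ rowLen n i

inDiagram-sound : ∀ {n i j} → inDiagram n (i , j) ≡ true → InDiagram n i j
inDiagram-sound {n} {i} {j} inD with ∧-true inD
... | r₁ , rest with ∧-true rest
... | r₂ , rest′ with ∧-true rest′
... | c₁ , c₂ =
  mkInDiagram (witness (1 ≤? i) r₁) (witness (i ≤? n) r₂) (witness (1 ≤? j) c₁) (witness (j ≤? rowLen n i) c₂)

inDiagram-complete : ∀ {n i j} → InDiagram n i j → inDiagram n (i , j) ≡ true
inDiagram-complete {n} {i} {j} (mkInDiagram r₁ r₂ c₁ c₂) =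
  cong₂ _∧_ (≤?-true {1} {i} r₁)
    (cong₂ _∧_ (≤?-true {i} {n} r₂) (cong₂ _∧_ (≤?-true {1} {j} c₁) (≤?-true {j} {rowLen n i} c₂)))

outside-rowLen : ∀ {n i j} → rowLen n i < j → inDiagram n (i , j) ≡ false
outside-rowLen {n} {i} {j} long with inDiagram n (i , j) in inD
... | false = refl
... | true = ⊥-elim (<⇒≱ long (InDiagram.col≤rowLen (inDiagram-sound {n} {i} {j} inD)))

-- Row pair p consists of rows 2p+1 and 2p+2; a box among their first n − 2p columns has t boxes to
-- its left and s to its right.  For odd n the last row has one more box, the corner.
data Coord (n i j : ℕ) : Set where
  upper  : ∀ p s t → n ≡ p * 2 + suc (t + s) → i ≡ suc (p * 2) → j ≡ suc t → Coord n i j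
  lower  : ∀ p s t → 1 ≤ t + s → n ≡ p * 2 + suc (t + s) → i ≡ suc (suc (p * 2)) → j ≡ suc t → Coord n i j
  corner : ∀ p → n ≡ p * 2 + 1 → i ≡ suc (p * 2) → j ≡ 2 → Coord n i j

pairIndex-upper : ∀ p → (suc (p * 2) ∸ 1) / 2 ≡ p
pairIndex-upper p = m*n/n≡m p 2

pairIndex-lower : ∀ p → (suc (suc (p * 2)) ∸ 1) / 2 ≡ p
pairIndex-lower p = trans (+-distrib-/-∣ʳ 1 {p * 2} {2} (divides-refl p)) (m*n/n≡m p 2)

pairLength : ∀ p L → p * 2 + L ∸ 2 * p ≡ L
pairLength p L = trans (cong (p * 2 + L ∸_) (*-comm 2 p)) (m+n∸m≡n (p * 2) L)

rowLen-pair : ∀ p L i → (i ∸ 1) / 2 ≡ p → rowLen (p * 2 + L) i ≡ 2 ⊔ L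
rowLen-pair p L i eq = cong (2 ⊔_) (trans (cong (λ q → p * 2 + L ∸ 2 * q) eq) (pairLength p L))

coord⇒inDiagram : ∀ {n i j} → Coord n i j → inDiagram n (i , j) ≡ true
coord⇒inDiagram (upper p s t refl refl refl) = inDiagram-complete (mkInDiagram (s≤s z≤n) (m<m+n (p * 2) (s≤s z≤n)) (s≤s z≤n)
  (subst (suc t ≤_) (sym (rowLen-pair p (suc (t + s)) (suc (p * 2)) (pairIndex-upper p)))
         (≤-trans (s≤s (m≤m+n t s)) (m≤n⊔m 2 _))))
coord⇒inDiagram (lower p s t t+s≥1 refl refl refl) = inDiagram-complete (mkInDiagram (s≤s z≤n)
  (≤-trans (s≤s (m<m+n (p * 2) t+s≥1)) (≤-reflexive (sym (+-suc (p * 2) (t + s))))) (s≤s z≤n)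
  (subst (suc t ≤_) (sym (rowLen-pair p (suc (t + s)) (suc (suc (p * 2))) (pairIndex-lower p)))
         (≤-trans (s≤s (m≤m+n t s)) (m≤n⊔m 2 _))))
coord⇒inDiagram (corner p refl refl refl) = inDiagram-complete (mkInDiagram (s≤s z≤n) (≤-reflexive (+-comm 1 (p * 2))) (s≤s z≤n)
  (≤-reflexive (sym (rowLen-pair p 1 (suc (p * 2)) (pairIndex-upper p)))))

data PairView : ℕ → Set where
  first  : ∀ p → PairView (p * 2)
  second : ∀ p → PairView (suc (p * 2))

pairView : ∀ m → PairView m
pairView zero = first 0
pairView (suc zero) = second 0
pairView (suc (suc m)) with pairView m
... | first p = first (suc p)
... | second p = second (suc p)

room : ∀ {a n} → suc a ≤ n → ∃ λ r → n ≡ a + suc r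
room {a} a<n with r , a+1+r≡n ← m≤n⇒∃[o]m+o≡n a<n = r , trans (sym a+1+r≡n) (sym (+-suc a r))

upperRow-coord : ∀ p r t → suc t ≤ 2 ⊔ suc r → Coord (p * 2 + suc r) (suc (p * 2)) (suc t)
upperRow-coord p r t _ with t ≤? r
... | yes t≤r with s , refl ← m≤n⇒∃[o]m+o≡n t≤r = upper p s t refl refl refl
upperRow-coord p zero zero _ | no t≰r = ⊥-elim (t≰r z≤n)
upperRow-coord p zero (suc zero) _ | no _ = corner p refl refl refl
upperRow-coord p zero (suc (suc t)) (s≤s (s≤s ())) | no _
upperRow-coord p (suc r) t (s≤s t≤1+r) | no t≰r = ⊥-elim (t≰r t≤1+r)

lowerRow-coord : ∀ p r t → suc t ≤ suc (suc r) → Coord (p * 2 + suc (suc r)) (suc (suc (p * 2))) (suc t)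
lowerRow-coord p r t (s≤s t≤1+r) with s , t+s≡1+r ← m≤n⇒∃[o]m+o≡n t≤1+r =
  lower p s t (subst (1 ≤_) (sym t+s≡1+r) (s≤s z≤n)) (cong (λ x → p * 2 + suc x) (sym t+s≡1+r)) refl refl

inDiagram⇒coord : ∀ {n i j} → inDiagram n (i , j) ≡ true → Coord n i j
inDiagram⇒coord {n} {i} {j} inD with inDiagram-sound {n} {i} {j} inD
... | mkInDiagram (s≤s {n = m} z≤n) i≤n (s≤s {n = t} z≤n) j≤len with pairView m
...   | first p with r , refl ← room i≤n =
          upperRow-coord p r t (subst (suc t ≤_) (rowLen-pair p (suc r) (suc (p * 2)) (pairIndex-upper p)) j≤len)
...   | second p with r , n≡ ← room i≤n with refl ← trans n≡ (sym (+-suc (p * 2) (suc r))) =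
          lowerRow-coord p r t (subst (suc t ≤_) (rowLen-pair p (suc (suc r)) (suc (suc (p * 2))) (pairIndex-lower p)) j≤len)

antidiagonalRow : ∀ {n i j} → Coord n i j → ℕ
antidiagonalRow (upper p s t _ _ _) = suc (p * 4 + s)
antidiagonalRow (lower p s t _ _ _ _) = suc (suc (p * 4 + s))
antidiagonalRow (corner p _ _ _) = p * 4

antidiagonalRow-unique : ∀ a {n i j} (c : Coord n i j) → a + j ≡ n + i → a ≡ antidiagonalRow c
antidiagonalRow-unique a (upper p s t refl refl refl) dist = +-cancelʳ-≡ (suc t) a _ (trans dist (reorder p s t))
  where
  reorder : ∀ p s t → p * 2 + suc (t + s) + suc (p * 2) ≡ suc (p * 4 + s) + suc t
  reorder = solve-∀
antidiagonalRow-unique a (lower p s t _ refl refl refl) dist = +-cancelʳ-≡ (suc t) a _ (trans dist (reorder p s t))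
  where
  reorder : ∀ p s t → p * 2 + suc (t + s) + suc (suc (p * 2)) ≡ suc (suc (p * 4 + s)) + suc t
  reorder = solve-∀
antidiagonalRow-unique a (corner p refl refl refl) dist = +-cancelʳ-≡ 2 a _ (trans dist (reorder p))
  where
  reorder : ∀ p → p * 2 + 1 + suc (p * 2) ≡ p * 4 + 2
  reorder = solve-∀

target-excluded : ∀ {d a n i j} → suc d + a + j ≡ n + i → j ≡ n → a ≢ i
target-excluded {d} {a} {n} dist refl refl = m+1+n≢m (n + a) (trans (reorder d a n) dist)
  where
  reorder : ∀ d a n → n + a + suc d ≡ suc d + a + n
  reorder = solve-∀

-- Closed forms for the weights towards a target (a , n)

-- Candidate values of wt (i , j) (a , n) in the coordinates of Coord; they do not mention n.
record Profile : Set where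
  field
    onUpper onLower : ℕ → ℕ → ℕ → ℤ
    onCorner : ℕ → ℤ

value : Profile → ∀ {n i j} → Coord n i j → ℤ
value P (upper p s t _ _ _) = Profile.onUpper P p s t
value P (lower p s t _ _ _ _) = Profile.onLower P p s t
value P (corner p _ _ _) = Profile.onCorner P p

gap : ℕ → ℕ → Maybe ℕ
gap L zero = just L
gap zero (suc j) = nothing
gap (suc L) (suc j) = gap L j

gap-+ : ∀ t s → gap (t + s) t ≡ just s
gap-+ zero s = refl
gap-+ (suc t) s = gap-+ t s

atPair : Profile → ℕ → ℕ → ℕ → ℕ → ℤ
atPair P p L r j = maybe′ (λ s → inRow r p s (j ∸ 1)) (Profile.onCorner P p) (gap L j)
  where
  inRow : ℕ → ℕ → ℕ → ℕ → ℤ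
  inRow zero = Profile.onUpper P
  inRow (suc _) = Profile.onLower P

-- Box (i , j) lies in pair p = ⌊(i − 1)/2⌋, in its upper row iff i − 1 is even; a column j beyond
-- the n − 2p ordinary columns of the pair can only be the corner.
at : Profile → ℕ → ℕ → ℕ → ℤ
at P n i j = atPair P p (n ∸ 2 * p) ((i ∸ 1) % 2) j
  where p = (i ∸ 1) / 2

at-coord : ∀ P {n i j} (c : Coord n i j) → at P n i j ≡ value P c
at-coord P (upper p s t refl refl refl) = begin
  atPair P ((p * 2) / 2) (p * 2 + suc (t + s) ∸ 2 * ((p * 2) / 2)) ((p * 2) % 2) (suc t)
    ≡⟨ cong₂ (λ q r → atPair P q (p * 2 + suc (t + s) ∸ 2 * q) r (suc t)) (pairIndex-upper p) (m*n%n≡0 p 2) ⟩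
  atPair P p (p * 2 + suc (t + s) ∸ 2 * p) 0 (suc t)
    ≡⟨ cong (λ L → atPair P p L 0 (suc t)) (pairLength p (suc (t + s))) ⟩
  maybe′ (λ s′ → Profile.onUpper P p s′ t) (Profile.onCorner P p) (gap (t + s) t)
    ≡⟨ cong (maybe′ _ _) (gap-+ t s) ⟩
  Profile.onUpper P p s t ∎
  where open ≡-Reasoning
at-coord P (lower p s t _ refl refl refl) = begin
  atPair P (suc (p * 2) / 2) (p * 2 + suc (t + s) ∸ 2 * (suc (p * 2) / 2)) (suc (p * 2) % 2) (suc t)
    ≡⟨ cong₂ (λ q r → atPair P q (p * 2 + suc (t + s) ∸ 2 * q) r (suc t)) (pairIndex-lower p) ([m+kn]%n≡m%n 1 p 2) ⟩
  atPair P p (p * 2 + suc (t + s) ∸ 2 * p) 1 (suc t)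
    ≡⟨ cong (λ L → atPair P p L 1 (suc t)) (pairLength p (suc (t + s))) ⟩
  maybe′ (λ s′ → Profile.onLower P p s′ t) (Profile.onCorner P p) (gap (t + s) t)
    ≡⟨ cong (maybe′ _ _) (gap-+ t s) ⟩
  Profile.onLower P p s t ∎
  where open ≡-Reasoning
at-coord P (corner p refl refl refl) =
  trans (cong₂ (λ q r → atPair P q (p * 2 + 1 ∸ 2 * q) r 2) (pairIndex-upper p) (m*n%n≡0 p 2))
        (cong (λ L → atPair P p L 0 2) (pairLength p 1))

rowSign-upper : ∀ p → rowSign (suc (p * 2)) ≡ + 1
rowSign-upper p = cong (λ r → if ⌊ r ≟ 0 ⌋ then + 1 else - + 1) (m*n%n≡0 p 2)

rowSign-lower : ∀ p → rowSign (suc (suc (p * 2))) ≡ - + 1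
rowSign-lower p = cong (λ r → if ⌊ r ≟ 0 ⌋ then + 1 else - + 1) ([m+kn]%n≡m%n 1 p 2)

upStep-at : ∀ P {n i j} (c : Coord n i j) → upStep n (at P n) (suc i) j ≡ value P c
upStep-at P {n} {i} {j} c = trans (if-true (cong₂ _∧_ inD (≤?-true (s≤s (InDiagram.row≥1 (inDiagram-sound {n} {i} {j} inD))))))
                                  (at-coord P c)
  where
  inD = coord⇒inDiagram c

rightStep-at : ∀ P {n i j} (c : Coord n i (suc j)) → rightStep n (at P n) i j ≡ rowSign i *ℤ value P c
rightStep-at P {n} {i} {j} c = trans (if-true (coord⇒inDiagram c)) (cong (rowSign i *ℤ_) (at-coord P c))

rightStep-upper : ∀ P {n j} p (c : Coord n (suc (p * 2)) (suc j)) → rightStep n (at P n) (suc (p * 2)) j ≡ value P c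
rightStep-upper P p c = trans (rightStep-at P c) (trans (cong (_*ℤ value P c) (rowSign-upper p)) (ℤ.*-identityˡ (value P c)))

rightStep-lower : ∀ P {n j} p (c : Coord n (suc (suc (p * 2))) (suc j)) → rightStep n (at P n) (suc (suc (p * 2))) j ≡ - value P c
rightStep-lower P p c = trans (rightStep-at P c) (trans (cong (_*ℤ value P c) (rowSign-lower p)) (ℤ.-1*i≡-i (value P c)))

rightStep-outside : ∀ {n i j} F → rowLen n i ≤ j → rightStep n F i j ≡ + 0
rightStep-outside {n} {i} {j} F long = if-false (outside-rowLen {n} {i} {suc j} (s≤s long))

rightStep-rowEnd : ∀ p t i F → (i ∸ 1) / 2 ≡ p → rightStep (p * 2 + suc (suc t + 0)) F i (suc (suc t)) ≡ + 0
rightStep-rowEnd p t i F eq = rightStep-outside {p * 2 + suc (suc t + 0)} {i} {suc (suc t)} F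
  (≤-reflexive (trans (rowLen-pair p (suc (suc t + 0)) i eq) (cong (λ m → suc (suc m)) (+-identityʳ t))))

-- The ends (1 , n) and (2 , n) of the first two rows are exempt when they are the target.
record Recurrence (P : Profile) (a : ℕ) : Set where
  open Profile P
  field
    first-row    : ∀ s t → onUpper 0 (suc s) t ≡ onUpper 0 s (suc t)
    first-end    : a ≢ 1 → ∀ t → onUpper 0 0 (suc t) ≡ + 0
    upper-step   : ∀ p s t → onUpper (suc p) (suc s) t ≡ onLower p (3 + s) t +ℤ onUpper (suc p) s (suc t)
    upper-corner : ∀ p → onUpper (suc p) 0 0 ≡ onLower p 2 0 +ℤ onCorner (suc p)
    upper-end    : ∀ p t → onUpper (suc p) 0 (suc t) ≡ onLower p 2 (suc t)
    lower-step   : ∀ p s t → onLower p (suc s) t ≡ onUpper p (suc s) t - onLower p s (suc t)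
    second-end   : a ≢ 2 → ∀ t → onLower 0 0 (suc t) ≡ onUpper 0 0 (suc t)
    lower-end    : ∀ p t → onLower (suc p) 0 (suc t) ≡ onUpper (suc p) 0 (suc t)
    corner-step  : ∀ p → onCorner (suc p) ≡ onLower p 1 1

module _ {P : Profile} {a : ℕ} (R : Recurrence P a) where
  open Profile P
  open Recurrence R
  open ≡-Reasoning

  at-upper-recurrence : ∀ {d} p s t → 2 ≤ p * 2 + suc (t + s) → suc d + a + suc t ≡ p * 2 + suc (t + s) + suc (p * 2) →
                        PathRecurrence (p * 2 + suc (t + s)) (at P (p * 2 + suc (t + s))) (suc (p * 2)) (suc t)
  at-upper-recurrence zero (suc s) t _ _ = begin
    at P n 1 (suc t)               ≡⟨ at-coord P (upper 0 (suc s) t refl refl refl) ⟩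
    onUpper 0 (suc s) t            ≡⟨ first-row s t ⟩
    onUpper 0 s (suc t)            ≡⟨ rightStep-upper P 0 (upper 0 s (suc t) (cong suc (+-suc t s)) refl refl) ⟨
    rightStep n (at P n) 1 (suc t) ≡⟨ ℤ.+-identityˡ _ ⟨
    + 0 +ℤ rightStep n (at P n) 1 (suc t) ∎
    where n = suc (t + suc s)
  at-upper-recurrence zero zero zero (s≤s ()) _
  at-upper-recurrence zero zero (suc t) _ dist = begin
    at P n 1 (suc (suc t))         ≡⟨ at-coord P (upper 0 0 (suc t) refl refl refl) ⟩
    onUpper 0 0 (suc t)            ≡⟨ first-end (target-excluded dist (cong (suc ∘ suc) (sym (+-identityʳ t)))) t ⟩
    + 0 +ℤ + 0                     ≡⟨ cong (+ 0 +ℤ_) (rightStep-rowEnd 0 t 1 (at P n) refl) ⟨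
    + 0 +ℤ rightStep n (at P n) 1 (suc (suc t)) ∎
    where n = suc (suc t + 0)
  at-upper-recurrence (suc p) s t _ _ = begin
    at P n i (suc t)              ≡⟨ at-coord P (upper (suc p) s t refl refl refl) ⟩
    onUpper (suc p) s t           ≡⟨ right s t ⟩
    onLower p (2 + s) t +ℤ rightStep n (at P n) i (suc t)
      ≡⟨ cong (_+ℤ rightStep n (at P n) i (suc t))
              (upStep-at P (lower p (2 + s) t (subst (1 ≤_) (sym (+-suc t (suc s))) (s≤s z≤n)) (pairAbove p t s) refl refl)) ⟨
    upStep n (at P n) i (suc t) +ℤ rightStep n (at P n) i (suc t) ∎
    where
    n = suc p * 2 + suc (t + s)
    i = suc (suc p * 2)
    pairAbove : ∀ p t s → suc p * 2 + suc (t + s) ≡ p * 2 + suc (t + (2 + s))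
    pairAbove = solve-∀
    right : ∀ s t → onUpper (suc p) s t
                    ≡ onLower p (2 + s) t +ℤ rightStep (suc p * 2 + suc (t + s)) (at P (suc p * 2 + suc (t + s))) i (suc t)
    right (suc s) t = trans (upper-step p s t) (sym (cong (onLower p (3 + s) t +ℤ_)
      (rightStep-upper P (suc p) (upper (suc p) s (suc t) (cong (λ m → suc p * 2 + suc m) (+-suc t s)) refl refl))))
    right zero zero = trans (upper-corner p) (sym (cong (onLower p 2 0 +ℤ_) (rightStep-upper P (suc p) (corner (suc p) refl refl refl))))
    right zero (suc t) = trans (upper-end p t) (sym (trans (cong (onLower p 2 (suc t) +ℤ_)
      (rightStep-rowEnd (suc p) t i (at P (suc p * 2 + suc (suc t + 0))) (pairIndex-upper (suc p)))) (ℤ.+-identityʳ _)))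

  at-lower-recurrence : ∀ {d} p s t → 1 ≤ t + s → suc d + a + suc t ≡ p * 2 + suc (t + s) + suc (suc (p * 2)) →
                        PathRecurrence (p * 2 + suc (t + s)) (at P (p * 2 + suc (t + s))) (suc (suc (p * 2))) (suc t)
  at-lower-recurrence {d} p s t t+s≥1 dist = begin
    at P n i (suc t)              ≡⟨ at-coord P (lower p s t t+s≥1 refl refl refl) ⟩
    onLower p s t                 ≡⟨ right s t t+s≥1 dist ⟩
    onUpper p s t +ℤ rightStep n (at P n) i (suc t)
      ≡⟨ cong (_+ℤ rightStep n (at P n) i (suc t)) (upStep-at P (upper p s t refl refl refl)) ⟨
    upStep n (at P n) i (suc t) +ℤ rightStep n (at P n) i (suc t) ∎
    where
    n = p * 2 + suc (t + s)
    i = suc (suc (p * 2))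
    right : ∀ s t → 1 ≤ t + s → suc d + a + suc t ≡ p * 2 + suc (t + s) + i →
            onLower p s t ≡ onUpper p s t +ℤ rightStep (p * 2 + suc (t + s)) (at P (p * 2 + suc (t + s))) i (suc t)
    right (suc s) t _ _ = trans (lower-step p s t) (sym (cong (onUpper p (suc s) t +ℤ_)
      (rightStep-lower P p (lower p s (suc t) (s≤s z≤n) (cong (λ m → p * 2 + suc m) (+-suc t s)) refl refl))))
    right zero (suc t) _ dist′ = trans (rowEnd p dist′) (sym (trans (cong (onUpper p 0 (suc t) +ℤ_)
      (rightStep-rowEnd p t i (at P (p * 2 + suc (suc t + 0))) (pairIndex-lower p))) (ℤ.+-identityʳ _)))
      where
      rowEnd : ∀ p → suc d + a + suc (suc t) ≡ p * 2 + suc (suc t + 0) + suc (suc (p * 2)) →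
               onLower p 0 (suc t) ≡ onUpper p 0 (suc t)
      rowEnd zero dist″ = second-end (target-excluded dist″ (cong (suc ∘ suc) (sym (+-identityʳ t)))) t
      rowEnd (suc p) _ = lower-end p t

  at-corner-recurrence : ∀ p → 2 ≤ p * 2 + 1 → PathRecurrence (p * 2 + 1) (at P (p * 2 + 1)) (suc (p * 2)) 2
  at-corner-recurrence zero (s≤s ())
  at-corner-recurrence (suc p) _ = begin
    at P n i 2                    ≡⟨ at-coord P (corner (suc p) refl refl refl) ⟩
    onCorner (suc p)              ≡⟨ corner-step p ⟩
    onLower p 1 1                 ≡⟨ upStep-at P (lower p 1 1 (s≤s z≤n) (pairAbove p) refl refl) ⟨
    upStep n (at P n) i 2         ≡⟨ ℤ.+-identityʳ _ ⟨
    upStep n (at P n) i 2 +ℤ + 0  ≡⟨ cong (upStep n (at P n) i 2 +ℤ_) (rightStep-outside {n} {i} {2} (at P n)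
                                       (≤-reflexive (rowLen-pair (suc p) 1 i (pairIndex-upper (suc p))))) ⟨
    upStep n (at P n) i 2 +ℤ rightStep n (at P n) i 2 ∎
    where
    n = suc p * 2 + 1
    i = suc (suc p * 2)
    pairAbove : ∀ p → suc p * 2 + 1 ≡ p * 2 + suc (1 + 1)
    pairAbove = solve-∀

  at-recurrence : ∀ {n d i j} → 2 ≤ n → Coord n i j → suc d + a + j ≡ n + i → PathRecurrence n (at P n) i j
  at-recurrence n≥2 (upper p s t refl refl refl) dist = at-upper-recurrence p s t n≥2 dist
  at-recurrence n≥2 (lower p s t t+s≥1 refl refl refl) dist = at-lower-recurrence p s t t+s≥1 dist
  at-recurrence n≥2 (corner p refl refl refl) _ = at-corner-recurrence p n≥2

n+n≤n*n : ∀ {n} → 2 ≤ n → n + n ≤ n * n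
n+n≤n*n {n} n≥2 = subst (_≤ n * n) (cong (λ m → n + m) (+-identityʳ n)) (*-monoˡ-≤ n n≥2)

Boundary : Profile → ℕ → Set
Boundary P a = ∀ {n i j} (c : Coord n i j) → a + j ≡ n + i → value P c ≡ (if boxEq (i , j) (a , n) then + 1 else + 0)

wt≡value : ∀ {P a} → Recurrence P a → Boundary P a →
  ∀ {n i j} → 2 ≤ n → 1 ≤ a → a + j ≤ n + i → (box : Coord n i j) → wt n (i , j) (a , n) ≡ value P box
wt≡value {P} {a} R boundary {n} {i} {j} n≥2 a≥1 a+j≤n+i box = begin
  wt n (i , j) (a , n)        ≡⟨ wt≡walkWt n i j a n d d<n² dist ⟩
  walkWt n d (i , j) (a , n)  ≡⟨ walkWt-unique n a n (at P n) base step d i j inD dist ⟩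
  at P n i j                  ≡⟨ at-coord P box ⟩
  value P box                 ∎
  where
  open ≡-Reasoning
  inD = coord⇒inDiagram box
  d = n + i ∸ (a + j)
  dist : d + a + j ≡ n + i
  dist = trans (+-assoc d a j) (m∸n+n≡m a+j≤n+i)
  d<n² : d < n * n
  d<n² = <-≤-trans (∸-monoʳ-< {o = 0} (≤-trans a≥1 (m≤m+n a j)) a+j≤n+i)
                   (≤-trans (+-monoʳ-≤ n (InDiagram.row≤n (inDiagram-sound {n} {i} {j} inD))) (n+n≤n*n n≥2))
  base : ∀ i j → inDiagram n (i , j) ≡ true → a + j ≡ n + i → at P n i j ≡ (if boxEq (i , j) (a , n) then + 1 else + 0)
  base i j inD₀ dist₀ = trans (at-coord P box₀) (boundary box₀ dist₀)
    where box₀ = inDiagram⇒coord {n} {i} {j} inD₀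
  step : ∀ d i j → inDiagram n (i , j) ≡ true → suc d + a + j ≡ n + i → PathRecurrence n (at P n) i j
  step d i j inD′ dist′ = at-recurrence R n≥2 (inDiagram⇒coord {n} {i} {j} inD′) dist′

onEven : Parity → ℤ → ℤ
onEven 0ℙ x = x
onEven 1ℙ _ = + 0

alternating : Parity → ℤ → ℤ
alternating 0ℙ x = x
alternating 1ℙ x = - x

data ParityStep (s : ℕ) : Set where
  even : parity s ≡ 0ℙ → parity (suc s) ≡ 1ℙ → ⌊ suc s /2⌋ ≡ ⌊ s /2⌋ → ParityStep s
  odd  : parity s ≡ 1ℙ → parity (suc s) ≡ 0ℙ → ⌊ suc s /2⌋ ≡ suc ⌊ s /2⌋ → ParityStep s

parityStep : ∀ s → ParityStep s
parityStep zero = even refl refl refl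
parityStep (suc zero) = odd refl refl refl
parityStep (suc (suc s)) with parityStep s
... | even ps ps′ h = even ps ps′ (cong suc h)
... | odd ps ps′ h = odd ps ps′ (cong suc h)

pathsToRow₁ : Profile
pathsToRow₁ = record
  { onUpper  = λ p s t → + ballot ⌊ s /2⌋ p
  ; onLower  = λ p s t → onEven (parity s) (+ ballot ⌊ s /2⌋ p)
  ; onCorner = λ _ → + 0
  }

pathsToRow₁-recurrence : Recurrence pathsToRow₁ 1
pathsToRow₁-recurrence = record
  { first-row    = λ s t → refl
  ; first-end    = λ 1≢1 → ⊥-elim (1≢1 refl)
  ; upper-step   = upper-step
  ; upper-corner = λ p → sym (ℤ.+-identityʳ _)
  ; upper-end    = λ p t → refl
  ; lower-step   = lower-step
  ; second-end   = λ _ t → refl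
  ; lower-end    = λ p t → refl
  ; corner-step  = λ p → refl
  }
  where
  upper-step : ∀ p s t → + ballot ⌊ suc s /2⌋ (suc p)
                         ≡ onEven (parity (suc s)) (+ ballot (suc ⌊ suc s /2⌋) p) +ℤ + ballot ⌊ s /2⌋ (suc p)
  upper-step p s t with parityStep s
  ... | even _ ps′ h rewrite ps′ | h = sym (ℤ.+-identityˡ _)
  ... | odd _ ps′ h rewrite ps′ | h = cong +_ (+-comm (ballot ⌊ s /2⌋ (suc p)) (ballot (suc (suc ⌊ s /2⌋)) p))
  lower-step : ∀ p s t → onEven (parity (suc s)) (+ ballot ⌊ suc s /2⌋ p)
                         ≡ + ballot ⌊ suc s /2⌋ p - onEven (parity s) (+ ballot ⌊ s /2⌋ p)
  lower-step p s t with parityStep s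
  ... | even ps ps′ h rewrite ps | ps′ | h = sym (ℤ.+-inverseʳ (+ ballot ⌊ s /2⌋ p))
  ... | odd ps ps′ h rewrite ps | ps′ | h = sym (ℤ.+-identityʳ _)

pathsToRow₁-boundary : Boundary pathsToRow₁ 1
pathsToRow₁-boundary (upper zero zero t refl refl refl) _ = sym (if-true (boxEq-refl 1 (cong suc (sym (+-identityʳ t)))))
pathsToRow₁-boundary c@(upper zero (suc s) t refl refl refl) dist with () ← antidiagonalRow-unique 1 c dist
pathsToRow₁-boundary c@(upper (suc p) s t refl refl refl) dist with () ← antidiagonalRow-unique 1 c dist
pathsToRow₁-boundary c@(lower p s t _ refl refl refl) dist with () ← antidiagonalRow-unique 1 c dist
pathsToRow₁-boundary (corner zero refl refl refl) ()
pathsToRow₁-boundary c@(corner (suc p) refl refl refl) dist with () ← antidiagonalRow-unique 1 c dist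

-- s = t = 0 only for the box left of the corner, which also reaches (2 , n) through the corner.
onUpper₂ : ℕ → ℕ → ℕ → ℤ
onUpper₂ zero s t = + 0
onUpper₂ (suc p) zero zero = + ballot 1 p - + ballot 0 p
onUpper₂ (suc p) s t = onEven (parity s) (+ ballot (suc ⌊ s /2⌋) p)

-- The corner of pair 0 only exists for n = 1, where (2 , n) is not a box.
onCorner₂ : ℕ → ℤ
onCorner₂ zero = + 0
onCorner₂ (suc p) = - + ballot 0 p

pathsToRow₂ : Profile
pathsToRow₂ = record
  { onUpper  = onUpper₂
  ; onLower  = λ p s t → alternating (parity s) (+ ballot ⌊ s /2⌋ p)
  ; onCorner = onCorner₂
  }

pathsToRow₂-recurrence : Recurrence pathsToRow₂ 2
pathsToRow₂-recurrence = record
  { first-row    = λ s t → refl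
  ; first-end    = λ _ t → refl
  ; upper-step   = upper-step
  ; upper-corner = λ p → refl
  ; upper-end    = λ p t → refl
  ; lower-step   = lower-step
  ; second-end   = λ 2≢2 → ⊥-elim (2≢2 refl)
  ; lower-end    = λ p t → refl
  ; corner-step  = λ p → refl
  }
  where
  upper-step : ∀ p s t → onUpper₂ (suc p) (suc s) t
                         ≡ alternating (parity (suc s)) (+ ballot (suc ⌊ suc s /2⌋) p) +ℤ onUpper₂ (suc p) s (suc t)
  upper-step p zero t = sym (ℤ.+-inverseˡ (+ ballot 1 p))
  upper-step p (suc s) t with parityStep s
  ... | even ps ps′ _ rewrite ps | ps′ = sym (ℤ.+-identityʳ _)
  ... | odd ps ps′ h rewrite ps | ps′ | h = sym (ℤ.+-inverseˡ (+ ballot (suc (suc ⌊ s /2⌋)) p))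
  lower-step : ∀ p s t → alternating (parity (suc s)) (+ ballot ⌊ suc s /2⌋ p)
                         ≡ onUpper₂ p (suc s) t - alternating (parity s) (+ ballot ⌊ s /2⌋ p)
  lower-step zero s t with parityStep s
  ... | even ps ps′ _ rewrite ps | ps′ = refl
  ... | odd ps ps′ _ rewrite ps | ps′ = refl
  lower-step (suc p) s t with parityStep s
  ... | even ps ps′ h rewrite ps | ps′ | h = sym (ℤ.+-identityˡ _)
  ... | odd ps ps′ h rewrite ps | ps′ | h =
    trans (cong +_ (+-comm (ballot ⌊ s /2⌋ (suc p)) (ballot (suc (suc ⌊ s /2⌋)) p)))
          (cong (+ ballot (suc (suc ⌊ s /2⌋)) p +ℤ_) (sym (ℤ.neg-involutive (+ ballot ⌊ s /2⌋ (suc p)))))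

pathsToRow₂-boundary : Boundary pathsToRow₂ 2
pathsToRow₂-boundary (upper zero s t refl refl refl) _ = refl
pathsToRow₂-boundary c@(upper (suc p) s t refl refl refl) dist with () ← antidiagonalRow-unique 2 c dist
pathsToRow₂-boundary (lower zero zero t _ refl refl refl) _ = sym (if-true (boxEq-refl 2 (cong suc (sym (+-identityʳ t)))))
pathsToRow₂-boundary c@(lower zero (suc s) t _ refl refl refl) dist with () ← antidiagonalRow-unique 2 c dist
pathsToRow₂-boundary c@(lower (suc p) s t _ refl refl refl) dist with () ← antidiagonalRow-unique 2 c dist
pathsToRow₂-boundary (corner zero refl refl refl) ()
pathsToRow₂-boundary c@(corner (suc p) refl refl refl) dist with () ← antidiagonalRow-unique 2 c dist

wt-toRow₁ : ∀ {n c} → 2 ≤ n → c ≤ 2 → (box : Coord n n c) → wt n (n , c) (1 , n) ≡ value pathsToRow₁ box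
wt-toRow₁ n≥2 c≤2 = wt≡value pathsToRow₁-recurrence pathsToRow₁-boundary n≥2 ≤-refl
  (+-mono-≤ (≤-trans (s≤s z≤n) n≥2) (≤-trans c≤2 n≥2))

wt-toRow₂ : ∀ {n c} → 2 ≤ n → c ≤ 2 → (box : Coord n n c) → wt n (n , c) (2 , n) ≡ value pathsToRow₂ box
wt-toRow₂ n≥2 c≤2 = wt≡value pathsToRow₂-recurrence pathsToRow₂-boundary n≥2 (s≤s z≤n)
  (+-mono-≤ n≥2 (≤-trans c≤2 n≥2))

weights-even : ∀ {n} k → n ≡ 2 * k → 2 ≤ n →
  (wt n (n , 1) (1 , n) ≡ + 0) × (wt n (n , 1) (2 , n) ≡ - (+ catalan (k ∸ 1))) ×
  (wt n (n , 2) (1 , n) ≡ + catalan (k ∸ 1)) × (wt n (n , 2) (2 , n) ≡ + catalan (k ∸ 1))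
weights-even zero refl ()
weights-even (suc q) refl n≥2 =
    wt-toRow₁ n≥2 (s≤s z≤n) (lastRow 1 0 refl)
  , trans (wt-toRow₂ n≥2 (s≤s z≤n) (lastRow 1 0 refl)) (cong (λ m → - + m) (sym (catalan≡ballot q)))
  , trans (wt-toRow₁ n≥2 ≤-refl (lastRow 0 1 refl)) (cong +_ (sym (catalan≡ballot q)))
  , trans (wt-toRow₂ n≥2 ≤-refl (lastRow 0 1 refl)) (cong +_ (sym (catalan≡ballot q)))
  where
  lastRow : ∀ s t → t + s ≡ 1 → Coord (2 * suc q) (2 * suc q) (suc t)
  lastRow s t t+s≡1 = lower q s t (≤-reflexive (sym t+s≡1))
    (trans (pairs q) (cong (λ m → q * 2 + suc m) (sym t+s≡1))) (lastRowIndex q) refl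
    where
    pairs : ∀ q → 2 * suc q ≡ q * 2 + suc 1
    pairs = solve-∀
    lastRowIndex : ∀ q → 2 * suc q ≡ suc (suc (q * 2))
    lastRowIndex = solve-∀

weights-odd : ∀ {n} k → n ≡ 2 * k + 1 → 2 ≤ n →
  (wt n (n , 1) (1 , n) ≡ + catalan k) ×
  (wt n (n , 2) (1 , n) ≡ + 0) × (wt n (n , 2) (2 , n) ≡ - (+ catalan (k ∸ 1)))
weights-odd zero refl (s≤s ())
weights-odd (suc q) refl n≥2 =
    trans (wt-toRow₁ n≥2 (s≤s z≤n) (upper k 0 0 (pairs k) (lastRowIndex k) refl)) (cong +_ (sym (catalan≡ballot k)))
  , wt-toRow₁ n≥2 ≤-refl (corner k (pairs k) (lastRowIndex k) refl)
  , trans (wt-toRow₂ n≥2 ≤-refl (corner k (pairs k) (lastRowIndex k) refl)) (cong (λ m → - + m) (sym (catalan≡ballot q)))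
  where
  k = suc q
  pairs : ∀ k → 2 * k + 1 ≡ k * 2 + 1
  pairs = solve-∀
  lastRowIndex : ∀ k → 2 * k + 1 ≡ suc (k * 2)
  lastRowIndex = solve-∀

theorem3p6 : (n : ℕ) → n ≥ 2 →
    ((k : ℕ) → n ≡ 2 * k →
      (wt n (n , 1) (1 , n) ≡ + 0) × (wt n (n , 1) (2 , n) ≡ - (+ catalan (k ∸ 1))) ×
      (wt n (n , 2) (1 , n) ≡ + catalan (k ∸ 1)) × (wt n (n , 2) (2 , n) ≡ + catalan (k ∸ 1)))
    × ((k : ℕ) → n ≡ 2 * k + 1 →
      (wt n (n , 1) (1 , n) ≡ + catalan k) ×
      (wt n (n , 2) (1 , n) ≡ + 0) × (wt n (n , 2) (2 , n) ≡ - (+ catalan (k ∸ 1))))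
theorem3p6 n n≥2 = (λ k n≡2k → weights-even k n≡2k n≥2) , (λ k n≡2k+1 → weights-odd k n≡2k+1 n≥2)
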